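{- Let $p$ be an odd prime, let $\theta$ be a generator of $\mathbb{F}_p^*$, and let $t \geq 1$ be an integer dividing $p-1$. Put $\mu = \theta^{(p-1)/t}$, $\Gamma = \mathbb{Z}_{(p-1)/t} \times \mathbb{F}_p$, and \[ S = \{ (m, \theta^m \mu^n) : m \in \mathbb{Z}_{(p-1)/t},\ 0 \leq n \leq t-1 \}, \] where $m$ is identified with its least nonnegative residue when computing $\theta^m$. Let $H_{p,t}$ be the graph with vertex set $\Gamma$ in which distinct vertices $(x,y),(a,b)$ are adjacent iff $(x,y)+(a,b)\in S$. Then $H_{p,t}$ has exactly $p-1$ vertices of degree $p-2$, and all other vertices have degree $p-1$. -}

module Defs where

open import Data.Nat using (ℕ; _+_; _*_; _∸_; _^_; _<_; _<?_; NonZero; _%_)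
import Data.Nat.Properties as ℕP
open import Data.Fin using (Fin; toℕ)
import Data.Fin.Properties as FinP
open import Data.Product using (_×_; _,_; ∃; Σ)
open import Data.Product.Properties using (≡-dec)
open import Data.List using (List; length; filter; allFin; cartesianProduct)
open import Relation.Nullary using (Dec; yes; no; ¬_)
open import Relation.Nullary.Decidable using (¬?; _×-dec_)
open import Relation.Binary.PropositionalEquality using (_≡_)

IsGenerator : (p : ℕ) → .{{NonZero p}} → ℕ → Set
IsGenerator p θ = ∀ a → 0 < a → a < p → ∃ λ k → (θ ^ k) % p ≡ a

addRes : (n : ℕ) → ℕ → ℕ → ℕ
addRes n a b with (a + b) <? n
... | yes _ = a + b
... | no  _ = (a + b) ∸ n

-- The graph H_{p,t}.  Parameters: p, θ, t, and q = (p-1)/t.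
-- Vertex set Γ = ℤ_q × 𝔽_p, represented as Fin q × Fin p.
module Hpt (p : ℕ) .{{_ : NonZero p}} (θ t q : ℕ) where

  μ : ℕ
  μ = θ ^ q

  Vertex : Set
  Vertex = Fin q × Fin p

  vertices : List Vertex
  vertices = cartesianProduct (allFin q) (allFin p)

  InS : ℕ → ℕ → Set
  InS m c = ∃ λ (n : Fin t) → ((θ ^ m) * (μ ^ toℕ n)) % p ≡ c

  InS? : ∀ m c → Dec (InS m c)
  InS? m c = FinP.any? (λ n → ℕP._≟_ (((θ ^ m) * (μ ^ toℕ n)) % p) c)

  SumInS : Vertex → Vertex → Set
  SumInS (x , y) (a , b) = InS (addRes q (toℕ x) (toℕ a)) (addRes p (toℕ y) (toℕ b))

  SumInS? : ∀ u v → Dec (SumInS u v)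
  SumInS? (x , y) (a , b) = InS? (addRes q (toℕ x) (toℕ a)) (addRes p (toℕ y) (toℕ b))

  _≟V_ : (u v : Vertex) → Dec (u ≡ v)
  _≟V_ = ≡-dec FinP._≟_ FinP._≟_

  Adj : Vertex → Vertex → Set
  Adj u v = ¬ (u ≡ v) × SumInS u v

  Adj? : ∀ u v → Dec (Adj u v)
  Adj? u v = ¬? (u ≟V v) ×-dec SumInS? u v

  degree : Vertex → ℕ
  degree u = length (filter (Adj? u) vertices)

-- For a fixed vertex u, v ↦ u + v permutes Γ, so u + v ∈ S for exactly |S| = p − 1
-- vertices v, and the degree of u is p − 1 − [2u ∈ S].  Here |S| = qt with q = (p−1)/t,
-- since for each m the t values θ^m μ^n = θ^(m + qn) are distinct: the exponents lie
-- below p − 1 and θ has order p − 1.  As p is odd, b ↦ 2b permutes 𝔽_p, so for every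
-- a ∈ ℤ_q exactly t values b satisfy 2(a , b) ∈ S; hence p − 1 vertices have degree p − 2.
module Submission where

open import Defs
open import Level using (Level)
open import Data.Nat using (ℕ; zero; suc; _+_; _*_; _∸_; _^_; _≤_; _<_; _<?_; _≟_; _%_; NonZero; z<s; s<s; >-nonZero)
open import Data.Nat.Properties
import Data.Nat.Properties as ℕP
open import Data.Nat.Divisibility using (_∣_; divides; ∣m+n∣m⇒∣n)
open import Data.Nat.DivMod using (_/_; m%n<n; m/n*n≡m; %-distribˡ-*)
open import Data.Nat.Primality using (Prime; ¬prime[0]; ¬prime[1])
open import Data.Nat.Induction using (<-wellFounded)
open import Induction.WellFounded using (Acc; acc)
open import Data.Fin using (Fin; zero; suc; toℕ; fromℕ<; punchOut)
import Data.Fin.Properties as Finₚ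
open import Data.List using (length; filter; tabulate; cartesianProduct; map; _++_)
open import Data.List.Properties using (filter-++; length-++; map-tabulate)
open import Data.Product using (_×_; _,_; ∃; proj₁; proj₂)
open import Data.Sum using (_⊎_; inj₁; inj₂)
open import Function using (_∘_; id)
open import Function.Definitions using (Injective)
open import Relation.Nullary using (Dec; yes; no; ¬_; contradiction)
open import Relation.Unary using (Pred; Decidable)
open import Relation.Binary.Definitions using (tri<; tri≈; tri>)
open import Relation.Binary.PropositionalEquality using (_≡_; _≢_; refl; sym; trans; cong; cong₂; subst; module ≡-Reasoning)
open import Algebra.Properties.CommutativeMonoid.Sum +-0-commutativeMonoid using (sum; sum-syntax; sum-cong-≗; sum-replicate-zero; ∑-comm)

private
  variable
    a b ℓ : Level
    A : Set a
    B : Set b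

𝟙 : Dec A → ℕ
𝟙 (yes _) = 1
𝟙 (no _)  = 0

𝟙-yes : A → (d : Dec A) → 𝟙 d ≡ 1
𝟙-yes x (yes _) = refl
𝟙-yes x (no ¬x) = contradiction x ¬x

𝟙-no : ¬ A → (d : Dec A) → 𝟙 d ≡ 0
𝟙-no ¬x (yes x) = contradiction x ¬x
𝟙-no ¬x (no _)  = refl

𝟙-cong : (A → B) → (B → A) → (d : Dec A) (e : Dec B) → 𝟙 d ≡ 𝟙 e
𝟙-cong f g (yes x) e = sym (𝟙-yes (f x) e)
𝟙-cong f g (no ¬x) e = sym (𝟙-no (¬x ∘ g) e)

+-𝟙≡suc : ∀ {m n} (d : Dec A) → m + 𝟙 d ≡ suc n → (A × m ≡ n) ⊎ (¬ A × m ≡ suc n)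
+-𝟙≡suc {m = m} (yes x) eq = inj₁ (x , suc-injective (trans (+-comm 1 m) eq))
+-𝟙≡suc {m = m} (no ¬x) eq = inj₂ (¬x , trans (sym (+-identityʳ m)) eq)

∑-const : ∀ n c → ∑[ i < n ] c ≡ n * c
∑-const zero    c = refl
∑-const (suc n) c = cong (c +_) (∑-const n c)

∑-agree-except : ∀ {n} (j : Fin n) (f g : Fin n → ℕ) c →
                 f j + c ≡ g j → (∀ i → j ≢ i → f i ≡ g i) → sum f + c ≡ sum g
∑-agree-except zero f g c fⱼ+c≡gⱼ agree = begin
  f zero + sum (f ∘ suc) + c    ≡⟨ +-assoc (f zero) _ c ⟩
  f zero + (sum (f ∘ suc) + c)  ≡⟨ cong (f zero +_) (+-comm _ c) ⟩
  f zero + (c + sum (f ∘ suc))  ≡⟨ +-assoc (f zero) c _ ⟨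
  f zero + c + sum (f ∘ suc)    ≡⟨ cong₂ _+_ fⱼ+c≡gⱼ (sum-cong-≗ (λ i → agree (suc i) Finₚ.0≢1+n)) ⟩
  g zero + sum (g ∘ suc)        ∎
  where open ≡-Reasoning
∑-agree-except (suc j) f g c fⱼ+c≡gⱼ agree = begin
  f zero + sum (f ∘ suc) + c    ≡⟨ +-assoc (f zero) _ c ⟩
  f zero + (sum (f ∘ suc) + c)  ≡⟨ cong₂ _+_ (agree zero (Finₚ.0≢1+n ∘ sym)) rest ⟩
  g zero + sum (g ∘ suc)        ∎
  where
  open ≡-Reasoning
  rest : sum (f ∘ suc) + c ≡ sum (g ∘ suc)
  rest = ∑-agree-except j (f ∘ suc) (g ∘ suc) c fⱼ+c≡gⱼ (λ i j≢i → agree (suc i) (j≢i ∘ Finₚ.suc-injective))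

∑-𝟙-injective : ∀ {n} (f : Fin n → ℕ) → Injective _≡_ _≡_ f →
                ∀ c (d : Dec (∃ λ i → f i ≡ c)) → ∑[ i < n ] 𝟙 (f i ≟ c) ≡ 𝟙 d
∑-𝟙-injective {zero}  f _     c d = sym (𝟙-no (λ { (() , _) }) d)
∑-𝟙-injective {suc n} f f-inj c d with f zero ≟ c
... | yes f₀≡c = begin
  1 + ∑[ i < n ] 𝟙 (f (suc i) ≟ c)  ≡⟨ cong (1 +_) (trans (sum-cong-≗ (λ i → 𝟙-no (fₛ≢c i) _)) (sum-replicate-zero n)) ⟩
  1                                 ≡⟨ 𝟙-yes (zero , f₀≡c) d ⟨
  𝟙 d                               ∎
  where
  open ≡-Reasoning
  fₛ≢c : ∀ i → f (suc i) ≢ c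
  fₛ≢c i fᵢ≡c = Finₚ.0≢1+n (f-inj (trans f₀≡c (sym fᵢ≡c)))
... | no f₀≢c = trans (∑-𝟙-injective (f ∘ suc) (Finₚ.suc-injective ∘ f-inj) c (Finₚ.any? (λ i → f (suc i) ≟ c))) (𝟙-cong shift unshift _ d)
  where
  shift : (∃ λ i → f (suc i) ≡ c) → ∃ λ i → f i ≡ c
  shift (i , eq) = suc i , eq
  unshift : (∃ λ i → f i ≡ c) → ∃ λ i → f (suc i) ≡ c
  unshift (zero  , eq) = contradiction eq f₀≢c
  unshift (suc i , eq) = i , eq

injective⇒surjective : ∀ {n} {f : Fin n → Fin n} → Injective _≡_ _≡_ f → ∀ y → ∃ λ x → f x ≡ y
injective⇒surjective {suc n} {f} f-inj y with Finₚ.any? (λ x → f x Finₚ.≟ y)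
... | yes hit  = hit
... | no  miss = contradiction (Finₚ.injective⇒≤ punchOut∘f-injective) 1+n≰n
  where
  missed : ∀ x → y ≢ f x
  missed x y≡fx = miss (x , sym y≡fx)
  punchOut∘f-injective : Injective _≡_ _≡_ (λ x → punchOut (missed x))
  punchOut∘f-injective eq = f-inj (Finₚ.punchOut-injective (missed _) (missed _) eq)

bounded-injective⇒surjective : ∀ {n} (φ : Fin n → ℕ) → Injective _≡_ _≡_ φ → (∀ b → φ b < n) →
                               ∀ {c} → c < n → ∃ λ b → φ b ≡ c
bounded-injective⇒surjective φ φ-inj φ<n {c} c<n =
  let b , eq = injective⇒surjective fromℕ<∘φ-injective (fromℕ< c<n)
  in b , trans (sym (Finₚ.toℕ-fromℕ< (φ<n b))) (trans (cong toℕ eq) (Finₚ.toℕ-fromℕ< c<n))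
  where
  fromℕ<∘φ-injective : Injective _≡_ _≡_ (λ b → fromℕ< (φ<n b))
  fromℕ<∘φ-injective eq = φ-inj (Finₚ.fromℕ<-injective _ _ (φ<n _) (φ<n _) eq)

∑-𝟙-preimage : ∀ {t n} (f : Fin t → ℕ) (φ : Fin n → ℕ) →
               Injective _≡_ _≡_ f → (∀ i → f i < n) →
               Injective _≡_ _≡_ φ → (∀ b → φ b < n) →
               (D : ∀ c → Dec (∃ λ i → f i ≡ c)) → ∑[ b < n ] 𝟙 (D (φ b)) ≡ t
∑-𝟙-preimage {t} {n} f φ f-inj f<n φ-inj φ<n D = begin
  ∑[ b < n ] 𝟙 (D (φ b))              ≡⟨ sum-cong-≗ (λ b → ∑-𝟙-injective f f-inj (φ b) (D (φ b))) ⟨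
  ∑[ b < n ] ∑[ i < t ] 𝟙 (f i ≟ φ b)  ≡⟨ ∑-comm (λ b i → 𝟙 (f i ≟ φ b)) ⟩
  ∑[ i < t ] ∑[ b < n ] 𝟙 (f i ≟ φ b)  ≡⟨ sum-cong-≗ {t} (λ i → sum-cong-≗ {n} (λ b → 𝟙-cong sym sym _ _)) ⟩
  ∑[ i < t ] ∑[ b < n ] 𝟙 (φ b ≟ f i)  ≡⟨ sum-cong-≗ (λ i → trans (∑-𝟙-injective φ φ-inj (f i) (Finₚ.any? (λ b → φ b ≟ f i))) (𝟙-yes (hit i) _)) ⟩
  ∑[ i < t ] 1                         ≡⟨ ∑-const t 1 ⟩
  t * 1                                ≡⟨ *-identityʳ t ⟩
  t                                    ∎
  where
  open ≡-Reasoning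
  hit : ∀ i → ∃ λ b → φ b ≡ f i
  hit i = bounded-injective⇒surjective φ φ-inj φ<n (f<n i)

length-filter-tabulate : ∀ {n} {P : Pred A ℓ} (P? : Decidable P) (f : Fin n → A) →
                         length (filter P? (tabulate f)) ≡ ∑[ i < n ] 𝟙 (P? (f i))
length-filter-tabulate {n = zero}  P? f = refl
length-filter-tabulate {n = suc n} P? f with P? (f zero)
... | yes _ = cong suc (length-filter-tabulate P? (f ∘ suc))
... | no  _ = length-filter-tabulate P? (f ∘ suc)

length-filter-cartesianProduct :
  ∀ {m n} {P : Pred (A × B) ℓ} (P? : Decidable P) (f : Fin m → A) (g : Fin n → B) →
  length (filter P? (cartesianProduct (tabulate f) (tabulate g))) ≡ ∑[ i < m ] ∑[ j < n ] 𝟙 (P? (f i , g j))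
length-filter-cartesianProduct {m = zero}  P? f g = refl
length-filter-cartesianProduct {m = suc m} P? f g = begin
  length (filter P? (row ++ rest))                   ≡⟨ cong length (filter-++ P? row rest) ⟩
  length (filter P? row ++ filter P? rest)           ≡⟨ length-++ (filter P? row) ⟩
  length (filter P? row) + length (filter P? rest)   ≡⟨ cong₂ _+_ first-row (length-filter-cartesianProduct P? (f ∘ suc) g) ⟩
  _                                                  ∎
  where
  open ≡-Reasoning
  row = map (f zero ,_) (tabulate g)
  rest = cartesianProduct (tabulate (f ∘ suc)) (tabulate g)
  first-row : length (filter P? row) ≡ ∑[ j < _ ] 𝟙 (P? (f zero , g j))
  first-row = trans (cong (length ∘ filter P?) (map-tabulate g (f zero ,_))) (length-filter-tabulate P? ((f zero ,_) ∘ g))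

addRes-cases : ∀ n a b → addRes n a b ≡ a + b ⊎ addRes n a b + n ≡ a + b
addRes-cases n a b with a + b <? n
... | yes _     = inj₁ refl
... | no  a+b≮n = inj₂ (m∸n+n≡m (≮⇒≥ a+b≮n))

addRes-< : ∀ {n a b} → a < n → b < n → addRes n a b < n
addRes-< {n} {a} {b} a<n b<n with a + b <? n
... | yes a+b<n = a+b<n
... | no  a+b≮n = +-cancelʳ-< n _ n (subst (_< n + n) (sym (m∸n+n≡m (≮⇒≥ a+b≮n))) (+-mono-< a<n b<n))

addRes-≡⇒ : ∀ {n a b c d} → addRes n a b ≡ addRes n c d →
            a + b ≡ c + d ⊎ a + b ≡ c + d + n ⊎ a + b + n ≡ c + d
addRes-≡⇒ {n} {a} {b} {c} {d} eq with addRes-cases n a b | addRes-cases n c d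
... | inj₁ e₁ | inj₁ e₂ = inj₁ (trans (sym e₁) (trans eq e₂))
... | inj₂ e₁ | inj₂ e₂ = inj₁ (trans (sym e₁) (trans (cong (_+ n) eq) e₂))
... | inj₂ e₁ | inj₁ e₂ = inj₂ (inj₁ (trans (sym e₁) (cong (_+ n) (trans eq e₂))))
... | inj₁ e₁ | inj₂ e₂ = inj₂ (inj₂ (trans (cong (_+ n) (trans (sym e₁) eq)) e₂))

addRes-injectiveʳ : ∀ {n} y {b b′} → b < n → b′ < n → addRes n y b ≡ addRes n y b′ → b ≡ b′
addRes-injectiveʳ {n} y {b} {b′} b<n b′<n eq with addRes-≡⇒ {n} {y} {b} {y} {b′} eq
... | inj₁ e        = +-cancelˡ-≡ y b b′ e
... | inj₂ (inj₁ e) = contradiction (subst (_< n) (+-cancelˡ-≡ y _ _ (trans e (+-assoc y b′ n))) b<n) (m+n≮n b′ n)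
... | inj₂ (inj₂ e) = contradiction (subst (_< n) (sym (+-cancelˡ-≡ y _ _ (trans (sym (+-assoc y b n)) e))) b′<n) (m+n≮n b n)

2∣m+m : ∀ m → 2 ∣ m + m
2∣m+m m = divides m (trans (cong (m +_) (sym (+-identityʳ m))) (*-comm 2 m))

addRes-double-injective : ∀ {n} → ¬ 2 ∣ n → ∀ {b b′} → addRes n b b ≡ addRes n b′ b′ → b ≡ b′
addRes-double-injective {n} odd {b} {b′} eq with addRes-≡⇒ {n} {b} {b} {b′} {b′} eq
... | inj₁ e        = *-cancelˡ-≡ b b′ 2 (trans (cong (b +_) (+-identityʳ b)) (trans e (cong (b′ +_) (sym (+-identityʳ b′)))))
... | inj₂ (inj₁ e) = contradiction (∣m+n∣m⇒∣n (subst (2 ∣_) e (2∣m+m b)) (2∣m+m b′)) odd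
... | inj₂ (inj₂ e) = contradiction (∣m+n∣m⇒∣n (subst (2 ∣_) (sym e) (2∣m+m b′)) (2∣m+m b)) odd

module _ {p : ℕ} .{{_ : NonZero p}} (θ : ℕ) where

  ^%-shift : ∀ {i j} c → θ ^ i % p ≡ θ ^ j % p → θ ^ (i + c) % p ≡ θ ^ (j + c) % p
  ^%-shift {i} {j} c eq = begin
    θ ^ (i + c) % p                ≡⟨ cong (_% p) (^-distribˡ-+-* θ i c) ⟩
    θ ^ i * θ ^ c % p              ≡⟨ %-distribˡ-* (θ ^ i) (θ ^ c) p ⟩
    (θ ^ i % p) * (θ ^ c % p) % p  ≡⟨ cong (λ r → r * (θ ^ c % p) % p) eq ⟩
    (θ ^ j % p) * (θ ^ c % p) % p  ≡⟨ %-distribˡ-* (θ ^ j) (θ ^ c) p ⟨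
    θ ^ j * θ ^ c % p              ≡⟨ cong (_% p) (^-distribˡ-+-* θ j c) ⟨
    θ ^ (j + c) % p                ∎
    where open ≡-Reasoning

  -- θ^k = θ^(j + (k − j)) ≡ θ^(i + (k − j)), and i + (k − j) < k.
  ^%-reduce : ∀ {i j} → i < j → θ ^ i % p ≡ θ ^ j % p →
              ∀ k → ∃ λ k′ → k′ < j × θ ^ k % p ≡ θ ^ k′ % p
  ^%-reduce {i} {j} i<j θⁱ≡θʲ k = go k (<-wellFounded k)
    where
    go : ∀ k → Acc _<_ k → ∃ λ k′ → k′ < j × θ ^ k % p ≡ θ ^ k′ % p
    go k (acc rec) with k <? j
    ... | yes k<j = k , k<j , refl
    ... | no  k≮j = let k′ , k′<j , eq = go (i + (k ∸ j)) (rec smaller) in k′ , k′<j , trans shifted eq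
      where
      j≤k : j ≤ k
      j≤k = ≮⇒≥ k≮j
      smaller : i + (k ∸ j) < k
      smaller = subst (i + (k ∸ j) <_) (m+[n∸m]≡n j≤k) (+-monoˡ-< (k ∸ j) i<j)
      shifted : θ ^ k % p ≡ θ ^ (i + (k ∸ j)) % p
      shifted = trans (cong (λ e → θ ^ e % p) (sym (m+[n∸m]≡n j≤k))) (sym (^%-shift {i} {j} (k ∸ j) θⁱ≡θʲ))

module _ {P θ : ℕ} (generator : IsGenerator (suc P) θ) where

  -- A repetition would make each of the P nonzero residues a power θ^e with e < j < P.
  ^%-no-repeat : ∀ {i j} → i < j → j < P → θ ^ i % suc P ≢ θ ^ j % suc P
  ^%-no-repeat {i} {j} i<j j<P θⁱ≡θʲ = <⇒≱ j<P (Finₚ.injective⇒≤ exponent-injective)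
    where
    exponent : (a : Fin P) → ∃ λ (e : Fin j) → θ ^ toℕ e % suc P ≡ suc (toℕ a)
    exponent a =
      let k , θᵏ≡a = generator (suc (toℕ a)) z<s (s<s (Finₚ.toℕ<n a))
          e , e<j , θᵏ≡θᵉ = ^%-reduce θ i<j θⁱ≡θʲ k
      in fromℕ< e<j , trans (cong (λ x → θ ^ x % suc P) (Finₚ.toℕ-fromℕ< e<j)) (trans (sym θᵏ≡θᵉ) θᵏ≡a)
    exponent-injective : Injective _≡_ _≡_ (proj₁ ∘ exponent)
    exponent-injective {a} {b} eq = Finₚ.toℕ-injective (suc-injective (begin
      suc (toℕ a)                              ≡⟨ proj₂ (exponent a) ⟨
      θ ^ toℕ (proj₁ (exponent a)) % suc P     ≡⟨ cong (λ e → θ ^ toℕ e % suc P) eq ⟩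
      θ ^ toℕ (proj₁ (exponent b)) % suc P     ≡⟨ proj₂ (exponent b) ⟩
      suc (toℕ b)                              ∎))
      where open ≡-Reasoning

  ^%-injective : ∀ {i j} → i < P → j < P → θ ^ i % suc P ≡ θ ^ j % suc P → i ≡ j
  ^%-injective {i} {j} i<P j<P eq with <-cmp i j
  ... | tri< i<j _ _ = contradiction eq (^%-no-repeat i<j j<P)
  ... | tri≈ _ i≡j _ = i≡j
  ... | tri> _ _ j<i = contradiction (sym eq) (^%-no-repeat j<i i<P)

module Degrees (P θ t : ℕ) .{{_ : NonZero t}} (t∣P : t ∣ P) (generator : IsGenerator (suc P) θ) where

  p q : ℕ
  p = suc P
  q = P / t

  open Hpt p θ t q public

  q*t≡P : q * t ≡ P
  q*t≡P = m/n*n≡m t∣P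

  fibre : ℕ → Fin t → ℕ
  fibre m n = θ ^ m * μ ^ toℕ n % p

  fibre≡θ^ : ∀ m n → fibre m n ≡ θ ^ (m + q * toℕ n) % p
  fibre≡θ^ m n = cong (_% p) (begin
    θ ^ m * (θ ^ q) ^ toℕ n  ≡⟨ cong (θ ^ m *_) (^-*-assoc θ q (toℕ n)) ⟩
    θ ^ m * θ ^ (q * toℕ n)  ≡⟨ ^-distribˡ-+-* θ m (q * toℕ n) ⟨
    θ ^ (m + q * toℕ n)      ∎)
    where open ≡-Reasoning

  fibre-injective : ∀ {m} → m < q → Injective _≡_ _≡_ (fibre m)
  fibre-injective {m} m<q {n} {n′} eq =
    Finₚ.toℕ-injective (*-cancelˡ-≡ (toℕ n) (toℕ n′) q (+-cancelˡ-≡ m _ _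
      (^%-injective generator (exponent<P n) (exponent<P n′) (trans (sym (fibre≡θ^ m n)) (trans eq (fibre≡θ^ m n′))))))
    where
    instance
      q≢0 : NonZero q
      q≢0 = >-nonZero (m<n⇒0<n m<q)
    exponent<P : ∀ n → m + q * toℕ n < P
    exponent<P n = begin-strict
      m + q * toℕ n    <⟨ +-monoˡ-< (q * toℕ n) m<q ⟩
      q + q * toℕ n    ≡⟨ *-suc q (toℕ n) ⟨
      q * suc (toℕ n)  ≤⟨ *-monoʳ-≤ q (Finₚ.toℕ<n n) ⟩
      q * t            ≡⟨ q*t≡P ⟩
      P                ∎
      where open ≤-Reasoning

  ∑-𝟙-InS : (ρ : Fin q → ℕ) → (∀ a → ρ a < q) →
            (φ : Fin q → Fin p → ℕ) → (∀ a → Injective _≡_ _≡_ (φ a)) → (∀ a b → φ a b < p) →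
            ∑[ a < q ] ∑[ b < p ] 𝟙 (InS? (ρ a) (φ a b)) ≡ P
  ∑-𝟙-InS ρ ρ<q φ φ-inj φ<p = begin
    ∑[ a < q ] ∑[ b < p ] 𝟙 (InS? (ρ a) (φ a b))  ≡⟨ sum-cong-≗ row-count ⟩
    ∑[ a < q ] t                                  ≡⟨ ∑-const q t ⟩
    q * t                                         ≡⟨ q*t≡P ⟩
    P                                             ∎
    where
    open ≡-Reasoning
    row-count : ∀ a → ∑[ b < p ] 𝟙 (InS? (ρ a) (φ a b)) ≡ t
    row-count a = ∑-𝟙-preimage (fibre (ρ a)) (φ a) (fibre-injective (ρ<q a)) (λ n → m%n<n (θ ^ ρ a * μ ^ toℕ n) p)
                               (φ-inj a) (φ<p a) (InS? (ρ a))

  ∑-𝟙-SumInS : ∀ u → ∑[ a < q ] ∑[ b < p ] 𝟙 (SumInS? u (a , b)) ≡ P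
  ∑-𝟙-SumInS (x , y) =
    ∑-𝟙-InS (λ a → addRes q (toℕ x) (toℕ a)) (λ a → addRes-< (Finₚ.toℕ<n x) (Finₚ.toℕ<n a))
            (λ _ b → addRes p (toℕ y) (toℕ b))
            (λ _ eq → Finₚ.toℕ-injective (addRes-injectiveʳ (toℕ y) (Finₚ.toℕ<n _) (Finₚ.toℕ<n _) eq))
            (λ _ b → addRes-< (Finₚ.toℕ<n y) (Finₚ.toℕ<n b))

  ∑-𝟙-SumInS-diagonal : ¬ 2 ∣ p → ∑[ a < q ] ∑[ b < p ] 𝟙 (SumInS? (a , b) (a , b)) ≡ P
  ∑-𝟙-SumInS-diagonal odd =
    ∑-𝟙-InS (λ a → addRes q (toℕ a) (toℕ a)) (λ a → addRes-< (Finₚ.toℕ<n a) (Finₚ.toℕ<n a))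
            (λ _ b → addRes p (toℕ b) (toℕ b))
            (λ _ eq → Finₚ.toℕ-injective (addRes-double-injective odd eq))
            (λ _ b → addRes-< (Finₚ.toℕ<n b) (Finₚ.toℕ<n b))

  𝟙-Adj≡𝟙-SumInS : ∀ u v → u ≢ v → 𝟙 (Adj? u v) ≡ 𝟙 (SumInS? u v)
  𝟙-Adj≡𝟙-SumInS u v u≢v = 𝟙-cong proj₂ (u≢v ,_) (Adj? u v) (SumInS? u v)

  degree-+-𝟙-loop : ∀ u → degree u + 𝟙 (SumInS? u u) ≡ P
  degree-+-𝟙-loop u@(x , y) = begin
    degree u + 𝟙 (SumInS? u u)
      ≡⟨ cong (_+ 𝟙 (SumInS? u u)) (length-filter-cartesianProduct (Adj? u) id id) ⟩
    ∑[ a < q ] ∑[ b < p ] 𝟙 (Adj? u (a , b)) + 𝟙 (SumInS? u u)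
      ≡⟨ ∑-agree-except x _ _ _ row-x other-rows ⟩
    ∑[ a < q ] ∑[ b < p ] 𝟙 (SumInS? u (a , b))
      ≡⟨ ∑-𝟙-SumInS u ⟩
    P ∎
    where
    open ≡-Reasoning
    row-x : ∑[ b < p ] 𝟙 (Adj? u (x , b)) + 𝟙 (SumInS? u u) ≡ ∑[ b < p ] 𝟙 (SumInS? u (x , b))
    row-x = ∑-agree-except y (λ b → 𝟙 (Adj? u (x , b))) (λ b → 𝟙 (SumInS? u (x , b))) _ (cong (_+ 𝟙 (SumInS? u u)) (𝟙-no (λ (u≢u , _) → u≢u refl) (Adj? u u)))
                           (λ b y≢b → 𝟙-Adj≡𝟙-SumInS u (x , b) (y≢b ∘ cong proj₂))
    other-rows : ∀ a → x ≢ a → ∑[ b < p ] 𝟙 (Adj? u (a , b)) ≡ ∑[ b < p ] 𝟙 (SumInS? u (a , b))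
    other-rows a x≢a = sum-cong-≗ {p} (λ b → 𝟙-Adj≡𝟙-SumInS u (a , b) (x≢a ∘ cong proj₁))

lemma4p2 : (p : ℕ) .{{_ : NonZero p}} → Prime p → ¬ (2 ∣ p) →
             (θ : ℕ) → θ < p → IsGenerator p θ →
             (t : ℕ) .{{_ : NonZero t}} → t ∣ (p ∸ 1) →
             let open Hpt p θ t ((p ∸ 1) / t) in
             (length (filter (λ u → degree u ℕP.≟ (p ∸ 2)) vertices) ≡ p ∸ 1)
             × (∀ u → ¬ (degree u ≡ p ∸ 2) → degree u ≡ p ∸ 1)
lemma4p2 zero          p-prime = contradiction p-prime ¬prime[0]
lemma4p2 (suc zero)    p-prime = contradiction p-prime ¬prime[1]
lemma4p2 (suc (suc P)) _ odd θ _ generator t t∣p-1 = count-degree-P , degree≢P⇒≡suc-P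
  where
  open Degrees (suc P) θ t t∣p-1 generator

  degree-cases : ∀ u → (SumInS u u × degree u ≡ P) ⊎ (¬ SumInS u u × degree u ≡ suc P)
  degree-cases u = +-𝟙≡suc (SumInS? u u) (degree-+-𝟙-loop u)

  degree≡P⇒loop : ∀ u → degree u ≡ P → SumInS u u
  degree≡P⇒loop u deg≡P with degree-cases u
  ... | inj₁ (loop , _)     = loop
  ... | inj₂ (_ , deg≡suc-P) = contradiction (trans (sym deg≡suc-P) deg≡P) 1+n≢n

  loop⇒degree≡P : ∀ u → SumInS u u → degree u ≡ P
  loop⇒degree≡P u loop with degree-cases u
  ... | inj₁ (_ , deg≡P)  = deg≡P
  ... | inj₂ (¬loop , _)  = contradiction loop ¬loop

  count-degree-P : length (filter (λ u → degree u ≟ P) vertices) ≡ suc P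
  count-degree-P = begin
    length (filter (λ u → degree u ≟ P) vertices)        ≡⟨ length-filter-cartesianProduct (λ u → degree u ≟ P) id id ⟩
    ∑[ a < q ] ∑[ b < p ] 𝟙 (degree (a , b) ≟ P)         ≡⟨ sum-cong-≗ (λ a → sum-cong-≗ {p} (λ b → 𝟙-cong (degree≡P⇒loop (a , b)) (loop⇒degree≡P (a , b)) (degree (a , b) ≟ P) (SumInS? (a , b) (a , b)))) ⟩
    ∑[ a < q ] ∑[ b < p ] 𝟙 (SumInS? (a , b) (a , b))   ≡⟨ ∑-𝟙-SumInS-diagonal odd ⟩
    suc P                                                ∎
    where open ≡-Reasoning

  degree≢P⇒≡suc-P : ∀ u → degree u ≢ P → degree u ≡ suc P
  degree≢P⇒≡suc-P u deg≢P with degree-cases u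
  ... | inj₁ (_ , deg≡P)     = contradiction deg≡P deg≢P
  ... | inj₂ (_ , deg≡suc-P) = deg≡suc-P
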